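{- For each integer $n\geq 1$, let $\tilde a_n$ be the smallest integer $k\geq 1$ such that $r_k(n)$ is prime, if the sequence $(r_k(n))_{k\geq 0}$ contains a prime, and let $\tilde a_n=-1$ otherwise. Then: (1) if $n=\mathcal{T}_2(j)$ where $j=2(\ell^2-1)$ for some integer $\ell\geq 2$, then $\tilde a_n=-1$; (2) if $n=\mathcal{T}_p(j)$ for some integer $j\geq 3$ and some odd prime $p$, then either $r_{(p-1)/2}(n)$ is not prime and $\tilde a_n=-1$, or $r_{(p-1)/2}(n)$ is the only prime in the sequence $(r_k(n))_{k\geq 0}$ and $\tilde a_n=(p-1)/2$.
   Context: For an integer $n$, the sequence $(r_k(n))_{k\in\mathbb{Z}}$ is defined by $r_0(n)=1$, $r_1(n)=n-1$ and $r_{k+2}(n)=n\,r_{k+1}(n)-r_k(n)$ for all $k\in\mathbb{Z}$. The dilated Chebyshev polynomials of the first kind $\mathcal{T}_k$ ($k\in\mathbb{Z}$) are the polynomials with $\mathcal{T}_k(2\cos\theta)=2\cos(k\theta)$; equivalently $\mathcal{T}_0(x)=2$, $\mathcal{T}_1(x)=x$, $\mathcal{T}_{k+2}(x)=x\,\mathcal{T}_{k+1}(x)-\mathcal{T}_k(x)$. In particular $\mathcal{T}_2(j)=j^2-2$. -}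

module Defs where

open import Data.Nat using (ℕ; zero; suc) renaming (_≤_ to _≤ℕ_; _<_ to _<ℕ_)
open import Data.Nat.Primality using (Prime)
open import Data.Integer using (ℤ; +_; -[1+_]; _+_; _-_; _*_)
open import Data.Product using (Σ; _×_)
open import Data.Sum using (_⊎_)
open import Relation.Binary.PropositionalEquality using (_≡_)
open import Relation.Nullary using (¬_)

r : ℕ → ℤ → ℤ
r zero n = + 1
r (suc zero) n = n - + 1
r (suc (suc k)) n = n * r (suc k) n - r k n

T : ℕ → ℤ → ℤ
T zero x = + 2
T (suc zero) x = x
T (suc (suc k)) x = x * T (suc k) x - T k x

IsPrimeℤ : ℤ → Set
IsPrimeℤ z = Σ ℕ (λ p → (z ≡ + p) × Prime p)

ATilde : ℤ → ℤ → Set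
ATilde n a =
  ((a ≡ -[1+ 0 ]) × (∀ (k : ℕ) → ¬ IsPrimeℤ (r k n)))
  ⊎ Σ ℕ (λ k → (a ≡ + k) × (1 ≤ℕ k) × IsPrimeℤ (r k n)
                × (∀ (m : ℕ) → 1 ≤ℕ m → m <ℕ k → ¬ IsPrimeℤ (r m n)))

-- Write x = 2cos θ, so that r_k(x) = sin((2k+1)θ/2) / sin(θ/2).  Then r behaves like a
-- divisibility sequence indexed by the odd numbers 2k+1: with p = 2h+1 one has
-- r_c(T_p(x)) · r_h(x) = r_{cp+h}(x), so r_h ∣ r_k whenever 2h+1 ∣ 2k+1, and a Euclidean
-- descent shows that a common divisor of r_a and r_b divides r_c with 2c+1 ∣ 2a+1, 2b+1.
-- For x ≥ 3 the terms are natural numbers increasing in k and in x.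
--
-- (2) Let n = T_p(j) with p = 2h+1 prime and k ≠ h.  If p ∣ 2k+1, then r_h(n) is a proper divisor
-- of r_k(n).  Otherwise r_k(j) divides r_{kp+h}(j) = r_k(n) r_h(j) and is coprime to r_h(j), so
-- r_k(j) is a proper divisor of r_k(n).  Hence r_h(n) is the only candidate for a prime.
--
-- (1) Let J = 2(ℓ² − 1) and n = J² − 2.  A Cassini-type identity gives
-- J r_k(n) = (J + 2) r_k(J)² − 2, that is (ℓ² − 1) r_k(n) = (ℓP − 1)(ℓP + 1) with P = r_k(J).
-- A prime r_k(n) would divide one of the two factors, forcing ℓ² − 1 ≥ ℓP − 1, but P > ℓ.
module Submission where

open import Defs
open import Data.Nat using (ℕ; ⌊_/2⌋; _∸_)
open import Data.Nat.Primality using (Prime)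
open import Data.Integer using (ℤ; +_; -[1+_]; _-_; _*_; _≤_)
open import Data.Product using (_×_)
open import Data.Sum using (_⊎_)
open import Relation.Binary.PropositionalEquality using (_≡_)
open import Relation.Nullary using (¬_)

open import Data.Nat as ℕ using (zero; suc; NonZero; NonTrivial)
import Data.Nat.Properties as ℕ
open import Data.Nat.Divisibility using (_∣_; _∣?_; divides; ∣-refl; ∣m∣n⇒∣m+n; ∣m+n∣m⇒∣n; ∣1⇒≡1)
open import Data.Nat.Coprimality using (Coprime; coprime-divisor)
open import Data.Nat.Primality
  using (prime?; euclidsLemma; prime⇒nonZero; prime⇒irreducible; ¬prime[1]; composite; composite⇒¬prime)
open import Data.Nat.Induction using (<-wellFounded)
open import Data.Nat.Tactic.RingSolver using () renaming (solve-∀ to ℕ-solve-∀)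
open import Data.Integer using (_+_; +≤+)
import Data.Integer.Properties as ℤ
import Data.Integer.Divisibility.Signed as ℤᵈ
open ℤᵈ using () renaming (_∣_ to _∣ℤ_)
open import Data.Integer.Tactic.RingSolver using (solve-∀)
open import Data.Product using (_,_; proj₁; ∃-syntax)
open import Data.Sum using (inj₁; inj₂; [_,_]′)
open import Data.Empty using (⊥-elim)
open import Induction.WellFounded using (Acc; acc)
open import Relation.Binary.Definitions using (tri<; tri≈; tri>)
open import Relation.Binary.PropositionalEquality
  using (refl; sym; trans; cong; cong₂; subst; subst₂; module ≡-Reasoning)
open import Relation.Nullary using (Dec; yes; no)
open import Relation.Nullary.Decidable using (decidable-stable)

-- Solutions of the recurrence

record Solves (x : ℤ) (f : ℕ → ℤ) : Set where
  constructor solves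
  field recurrence : ∀ k → f (2 ℕ.+ k) ≡ x * f (1 ℕ.+ k) - f k
open Solves

r-solves : ∀ x → Solves x (λ k → r k x)
r-solves x = solves λ k → refl

T-solves : ∀ x → Solves x (λ k → T k x)
T-solves x = solves λ k → refl

solves-unique : ∀ {x f g} → Solves x f → Solves x g → f 0 ≡ g 0 → f 1 ≡ g 1 → ∀ k → f k ≡ g k
solves-unique {x} {f} {g} sf sg e₀ e₁ k = proj₁ (agree k)
  where
  agree : ∀ k → f k ≡ g k × f (suc k) ≡ g (suc k)
  agree zero = e₀ , e₁
  agree (suc k) with agree k
  ... | eₖ , eₖ₊₁ =
    eₖ₊₁ , trans (recurrence sf k) (trans (cong₂ (λ a b → x * a - b) eₖ₊₁ eₖ) (sym (recurrence sg k)))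

solves-*ʳ : ∀ {x f} c → Solves x f → Solves x (λ k → f k * c)
solves-*ʳ {x} {f} c sf = solves λ k → trans (cong (_* c) (recurrence sf k)) (distrib x (f (suc k)) (f k) c)
  where
  distrib : ∀ x a b c → (x * a - b) * c ≡ x * (a * c) - b * c
  distrib = solve-∀

private
  AdditionLaw : ℤ → (ℕ → ℤ) → ℕ → ℕ → Set
  AdditionLaw x f m s = f (m ℕ.+ (m ℕ.+ s)) + f s ≡ T m x * f (m ℕ.+ s)

  addition-step : ∀ {x f} → Solves x f → ∀ m s →
    AdditionLaw x f (suc m) (suc s) → AdditionLaw x f m (2 ℕ.+ s) → AdditionLaw x f (2 ℕ.+ m) s
  addition-step {x} {f} sf m s ih₁ ih₂ = begin
    f (2 ℕ.+ k) + f s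
      ≡⟨ cong (_+ f s) (recurrence sf k) ⟩
    (x * f (1 ℕ.+ k) - f k) + f s
      ≡⟨ regroup x (f (1 ℕ.+ k)) (f k) (f (1 ℕ.+ s)) (f s) ⟩
    x * (f (1 ℕ.+ k) + f (1 ℕ.+ s)) - (f k + (x * f (1 ℕ.+ s) - f s))
      ≡⟨ cong (λ a → x * (f (1 ℕ.+ k) + f (1 ℕ.+ s)) - (f k + a)) (sym (recurrence sf s)) ⟩
    x * (f (1 ℕ.+ k) + f (1 ℕ.+ s)) - (f k + f (2 ℕ.+ s))
      ≡⟨ cong₂ (λ a b → x * a - b) ih₁′ ih₂′ ⟩
    x * (T (suc m) x * f c) - T m x * f c
      ≡⟨ factor x (T (suc m) x) (T m x) (f c) ⟩
    (x * T (suc m) x - T m x) * f c ∎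
    where
    open ≡-Reasoning
    k c : ℕ
    k = m ℕ.+ suc (suc (m ℕ.+ s))
    c = suc (suc (m ℕ.+ s))
    ih₁′ : f (1 ℕ.+ k) + f (1 ℕ.+ s) ≡ T (suc m) x * f c
    ih₁′ = subst₂ (λ i j → f i + f (1 ℕ.+ s) ≡ T (suc m) x * f j) (outer m s) (centre m s) ih₁
      where
      outer : ∀ m s → suc (m ℕ.+ suc (m ℕ.+ suc s)) ≡ suc (m ℕ.+ suc (suc (m ℕ.+ s)))
      outer = ℕ-solve-∀
      centre : ∀ m s → suc m ℕ.+ suc s ≡ suc (suc (m ℕ.+ s))
      centre = ℕ-solve-∀
    ih₂′ : f k + f (2 ℕ.+ s) ≡ T m x * f c
    ih₂′ = subst₂ (λ i j → f i + f (2 ℕ.+ s) ≡ T m x * f j) (outer m s) (centre m s) ih₂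
      where
      outer : ∀ m s → m ℕ.+ (m ℕ.+ suc (suc s)) ≡ m ℕ.+ suc (suc (m ℕ.+ s))
      outer = ℕ-solve-∀
      centre : ∀ m s → m ℕ.+ suc (suc s) ≡ suc (suc (m ℕ.+ s))
      centre = ℕ-solve-∀
    regroup : ∀ x a b c d → (x * a - b) + d ≡ x * (a + c) - (b + (x * c - d))
    regroup = solve-∀
    factor : ∀ x t u a → x * (t * a) - u * a ≡ (x * t - u) * a
    factor = solve-∀

-- The analogue of cos((k + m)θ) + cos((k − m)θ) = 2 cos(mθ) cos(kθ), with k = s + m.
solves-addition : ∀ {x f} → Solves x f → ∀ m s → f (m ℕ.+ (m ℕ.+ s)) + f s ≡ T m x * f (m ℕ.+ s)
solves-addition sf zero s = double _
  where
  double : ∀ a → a + a ≡ + 2 * a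
  double = solve-∀
solves-addition {x} {f} sf (suc zero) s =
  trans (cong (_+ f s) (recurrence sf s)) (cancel (x * f (suc s)) (f s))
  where
  cancel : ∀ a b → (a - b) + b ≡ a
  cancel = solve-∀
solves-addition {x} {f} sf (suc (suc m)) s =
  addition-step {x} {f} sf m s (solves-addition sf (suc m) (suc s)) (solves-addition sf m (2 ℕ.+ s))

-- mirrored x N k = r_{k - N}(x), where negative indices are read through r_{-1-i} = r_i.
mirrored : ℤ → ℕ → ℕ → ℤ
mirrored x zero k = r k x
mirrored x (suc N) zero = r N x
mirrored x (suc N) (suc k) = mirrored x N k

mirrored-+ : ∀ x N i → mirrored x N (N ℕ.+ i) ≡ r i x
mirrored-+ x zero i = refl
mirrored-+ x (suc N) i = mirrored-+ x N i

mirrored-step : ∀ x N k → mirrored x N (2 ℕ.+ k) ≡ x * mirrored x N (1 ℕ.+ k) - mirrored x N k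
mirrored-step x zero k = refl
mirrored-step x (suc zero) zero = lemma x
  where
  lemma : ∀ x → x - + 1 ≡ x * + 1 - + 1
  lemma = solve-∀
mirrored-step x (suc (suc zero)) zero = lemma x
  where
  lemma : ∀ x → + 1 ≡ x * + 1 - (x - + 1)
  lemma = solve-∀
mirrored-step x (suc (suc (suc N))) zero = lemma x (r (suc N) x) (r N x)
  where
  lemma : ∀ x a b → b ≡ x * a - (x * a - b)
  lemma = solve-∀
mirrored-step x (suc N) (suc k) = mirrored-step x N k

mirrored-solves : ∀ x N → Solves x (mirrored x N)
mirrored-solves x N = solves (mirrored-step x N)

r-reflection : ∀ x u b → r (b ℕ.+ suc (u ℕ.+ b)) x + r u x ≡ T (suc (u ℕ.+ b)) x * r b x
r-reflection x u b =
  subst₂ (λ i j → i + r u x ≡ T m x * j) outer centre (solves-addition (mirrored-solves x (suc u)) m 0)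
  where
  m : ℕ
  m = suc (u ℕ.+ b)
  outer : mirrored x (suc u) (m ℕ.+ (m ℕ.+ 0)) ≡ r (b ℕ.+ m) x
  outer = trans (cong (mirrored x u) (index u b)) (mirrored-+ x u (b ℕ.+ m))
    where
    index : ∀ u b → u ℕ.+ b ℕ.+ (suc (u ℕ.+ b) ℕ.+ 0) ≡ u ℕ.+ (b ℕ.+ suc (u ℕ.+ b))
    index = ℕ-solve-∀
  centre : mirrored x (suc u) (m ℕ.+ 0) ≡ r b x
  centre = trans (cong (mirrored x u) (ℕ.+-identityʳ (u ℕ.+ b))) (mirrored-+ x u b)

odd : ℕ → ℕ
odd n = suc (n ℕ.+ n)

odd-injective : ∀ {a b} → odd a ≡ odd b → a ≡ b
odd-injective {a} {b} eq =
  trans (ℕ.n≡⌊n+n/2⌋ a) (trans (cong ⌊_/2⌋ (ℕ.suc-injective eq)) (sym (ℕ.n≡⌊n+n/2⌋ b)))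

even≢odd : ∀ a b → ¬ a ℕ.+ a ≡ odd b
even≢odd a b eq = ℕ.1+n≢n (trans (sym a≡1+b) a≡b)
  where
  a≡b : a ≡ b
  a≡b = trans (ℕ.n≡⌊n+n/2⌋ a) (trans (cong ⌊_/2⌋ eq) (sym (ℕ.n≡⌈n+n/2⌉ b)))
  a≡1+b : a ≡ suc b
  a≡1+b = trans (ℕ.n≡⌈n+n/2⌉ a) (trans (cong ℕ.⌈_/2⌉ eq) (cong suc (sym (ℕ.n≡⌊n+n/2⌋ b))))

parity : ∀ n → ∃[ h ] (n ≡ h ℕ.+ h ⊎ n ≡ odd h)
parity zero = 0 , inj₁ refl
parity (suc n) with parity n
... | h , inj₁ eq = h , inj₂ (cong suc eq)
... | h , inj₂ eq = suc h , inj₁ (cong suc (trans eq (sym (ℕ.+-suc h h))))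

odd-*-odd : ∀ c a → odd c ℕ.* odd a ≡ odd (c ℕ.* odd a ℕ.+ a)
odd-*-odd = lemma
  where
  lemma : ∀ c a → suc (c ℕ.+ c) ℕ.* suc (a ℕ.+ a)
                ≡ suc ((c ℕ.* suc (a ℕ.+ a) ℕ.+ a) ℕ.+ (c ℕ.* suc (a ℕ.+ a) ℕ.+ a))
  lemma = ℕ-solve-∀

odd∣odd⇒≡*odd+ : ∀ a b → odd a ∣ odd b → ∃[ c ] b ≡ c ℕ.* odd a ℕ.+ a
odd∣odd⇒≡*odd+ a b (divides q eq) with parity q
... | c , inj₁ refl = ⊥-elim (even≢odd (c ℕ.* odd a) b (sym (trans eq (ℕ.*-distribʳ-+ (odd a) c c))))
... | c , inj₂ refl = c , odd-injective (trans eq (odd-*-odd c a))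

odd-prime : ∀ {p} → Prime p → ¬ p ≡ 2 → ∃[ h ] 1 ℕ.≤ h × p ≡ odd h
odd-prime {p} pr p≢2 with parity p
... | zero , inj₂ refl = ⊥-elim (¬prime[1] pr)
... | suc h , inj₂ p≡ = suc h , ℕ.s≤s ℕ.z≤n , p≡
... | h , inj₁ p≡ with prime⇒irreducible pr (divides h (trans p≡ (double h)))
  where
  double : ∀ h → h ℕ.+ h ≡ h ℕ.* 2
  double = ℕ-solve-∀
...   | inj₁ ()
...   | inj₂ 2≡p = ⊥-elim (p≢2 (sym 2≡p))

-- Strong divisibility

r-progression-solves : ∀ x p h → Solves (T p x) (λ c → r (c ℕ.* p ℕ.+ h) x)
r-progression-solves x p h = solves λ c → a+b≡c⇒a≡c-b
  (subst₂ (λ i j → r i x + r (c ℕ.* p ℕ.+ h) x ≡ T p x * r j x) (outer p c h) (centre p c h)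
    (solves-addition (r-solves x) p (c ℕ.* p ℕ.+ h)))
  where
  outer : ∀ p c h → p ℕ.+ (p ℕ.+ (c ℕ.* p ℕ.+ h)) ≡ (2 ℕ.+ c) ℕ.* p ℕ.+ h
  outer = ℕ-solve-∀
  centre : ∀ p c h → p ℕ.+ (c ℕ.* p ℕ.+ h) ≡ (1 ℕ.+ c) ℕ.* p ℕ.+ h
  centre = ℕ-solve-∀
  a+b≡c⇒a≡c-b : ∀ {a b c} → a + b ≡ c → a ≡ c - b
  a+b≡c⇒a≡c-b {a} {b} refl = cancel a b
    where
    cancel : ∀ a b → a ≡ (a + b) - b
    cancel = solve-∀

r-T-composition : ∀ x h c → r c (T (odd h) x) * r h x ≡ r (c ℕ.* odd h ℕ.+ h) x
r-T-composition x h = solves-unique (solves-*ʳ (r h x) (r-solves (T p x))) (r-progression-solves x p h)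
                        (ℤ.*-identityˡ (r h x)) first
  where
  p : ℕ
  p = odd h
  first : (T p x - + 1) * r h x ≡ r (1 ℕ.* p ℕ.+ h) x
  first = begin
    (T p x - + 1) * r h x              ≡⟨ distrib (T p x) (r h x) ⟩
    T p x * r h x - r h x              ≡⟨ cong (_- r h x) (sym (r-reflection x h h)) ⟩
    (r (h ℕ.+ p) x + r h x) - r h x    ≡⟨ cancel (r (h ℕ.+ p) x) (r h x) ⟩
    r (h ℕ.+ p) x                      ≡⟨ cong (λ i → r i x) (index h p) ⟩
    r (1 ℕ.* p ℕ.+ h) x                ∎
    where
    open ≡-Reasoning
    distrib : ∀ t a → (t - + 1) * a ≡ t * a - a
    distrib = solve-∀
    cancel : ∀ a b → (a + b) - b ≡ a
    cancel = solve-∀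
    index : ∀ h p → h ℕ.+ p ≡ 1 ℕ.* p ℕ.+ h
    index = ℕ-solve-∀

r-∣-r : ∀ x a b → odd a ∣ odd b → r a x ∣ℤ r b x
r-∣-r x a b a∣b with odd∣odd⇒≡*odd+ a b a∣b
... | c , refl = ℤᵈ.divides (r c (T (odd a) x)) (sym (r-T-composition x a c))

-- In terms of odd numbers, the smaller index o (s resp. u) satisfies 2o+1 = |2(2b+1) - (2a+1)|,
-- and r a x + r o x is a multiple of r b x: one step of Euclid's algorithm.
data EuclidView : ℕ → ℕ → Set where
  near : ∀ m s → EuclidView (suc m ℕ.+ (suc m ℕ.+ s)) (suc m ℕ.+ s)
  far  : ∀ u b → EuclidView (b ℕ.+ suc (u ℕ.+ b)) b

euclidView : ∀ {a b} → b ℕ.< a → EuclidView a b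
euclidView {a} {b} b<a with ℕ.m≤n⇒∃[o]m+o≡n b<a
... | t , refl with t ℕ.<? b
...   | yes t<b with ℕ.m≤n⇒∃[o]m+o≡n t<b
...     | s , refl = subst (λ a → EuclidView a (suc t ℕ.+ s)) (index t s) (near t s)
  where
  index : ∀ t s → suc t ℕ.+ (suc t ℕ.+ s) ≡ suc (suc t ℕ.+ s ℕ.+ t)
  index = ℕ-solve-∀
euclidView {a} {b} b<a | t , refl | no t≮b with ℕ.m≤n⇒∃[o]m+o≡n (ℕ.≮⇒≥ t≮b)
...   | u , refl = subst (λ a → EuclidView a b) (index u b) (far u b)
  where
  index : ∀ u b → b ℕ.+ suc (u ℕ.+ b) ≡ suc (b ℕ.+ (b ℕ.+ u))
  index = ℕ-solve-∀

∣m∧∣n∧m+o≡t*n⇒∣o : ∀ {g m n o} t → g ∣ℤ m → g ∣ℤ n → m + o ≡ t * n → g ∣ℤ o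
∣m∧∣n∧m+o≡t*n⇒∣o {g} t g∣m g∣n eq = ℤᵈ.∣m+n∣m⇒∣n (subst (g ∣ℤ_) (sym eq) (ℤᵈ.∣n⇒∣m*n t g∣n)) g∣m

CommonOddIndex : ℤ → ℤ → ℕ → ℕ → Set
CommonOddIndex x g a b = ∃[ c ] odd c ∣ odd a × odd c ∣ odd b × g ∣ℤ r c x

private
  mutual
    common-index-below : ∀ x {g n} → Acc ℕ._<_ n → ∀ a b → a ℕ.< n → b ℕ.< n →
                         g ∣ℤ r a x → g ∣ℤ r b x → CommonOddIndex x g a b
    common-index-below x (acc rec) a b a<n b<n ga gb with ℕ.<-cmp a b
    ... | tri≈ _ refl _ = a , ∣-refl , ∣-refl , ga
    ... | tri> _ _ b<a = euclid-step x (rec a<n) (euclidView b<a) ga gb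
    ... | tri< a<b _ _ with euclid-step x (rec b<n) (euclidView a<b) gb ga
    ...   | c , c∣b , c∣a , gc = c , c∣a , c∣b , gc

    euclid-step : ∀ x {g a b} → Acc ℕ._<_ a → EuclidView a b →
                  g ∣ℤ r a x → g ∣ℤ r b x → CommonOddIndex x g a b
    euclid-step x {g} acc-a (near m s) ga gb with common-index-below x acc-a b s b<a s<a gb gs
      where
      b : ℕ
      b = suc m ℕ.+ s
      b<a : b ℕ.< suc m ℕ.+ b
      b<a = ℕ.m<n+m b ℕ.z<s
      s<a : s ℕ.< suc m ℕ.+ b
      s<a = ℕ.<-trans (ℕ.m<n+m s ℕ.z<s) b<a
      gs : g ∣ℤ r s x
      gs = ∣m∧∣n∧m+o≡t*n⇒∣o (T (suc m) x) ga gb (solves-addition (r-solves x) (suc m) s)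
    ... | c , c∣b , c∣s , gc =
      c , ∣m+n∣m⇒∣n (subst (odd c ∣_) (index m s) (∣m∣n⇒∣m+n c∣b c∣b)) c∣s , c∣b , gc
      where
      index : ∀ m s → let b = suc m ℕ.+ s; a = suc m ℕ.+ b in
              suc (b ℕ.+ b) ℕ.+ suc (b ℕ.+ b) ≡ suc (s ℕ.+ s) ℕ.+ suc (a ℕ.+ a)
      index = ℕ-solve-∀
    euclid-step x {g} acc-a (far u b) ga gb with common-index-below x acc-a b u b<a u<a gb gu
      where
      b<a : b ℕ.< b ℕ.+ suc (u ℕ.+ b)
      b<a = ℕ.m<m+n b ℕ.z<s
      u<a : u ℕ.< b ℕ.+ suc (u ℕ.+ b)
      u<a = ℕ.<-≤-trans (ℕ.s≤s (ℕ.m≤m+n u b)) (ℕ.m≤n+m _ b)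
      gu : g ∣ℤ r u x
      gu = ∣m∧∣n∧m+o≡t*n⇒∣o (T (suc (u ℕ.+ b)) x) ga gb (r-reflection x u b)
    ... | c , c∣b , c∣u , gc =
      c , subst (odd c ∣_) (index u b) (∣m∣n⇒∣m+n (∣m∣n⇒∣m+n c∣b c∣b) c∣u) , c∣b , gc
      where
      index : ∀ u b → let a = b ℕ.+ suc (u ℕ.+ b) in
              suc (b ℕ.+ b) ℕ.+ suc (b ℕ.+ b) ℕ.+ suc (u ℕ.+ u) ≡ suc (a ℕ.+ a)
      index = ℕ-solve-∀

r-common-divisor : ∀ x {g} a b → g ∣ℤ r a x → g ∣ℤ r b x → CommonOddIndex x g a b
r-common-divisor x a b = common-index-below x (<-wellFounded (suc (a ℕ.+ b))) a b
  (ℕ.s≤s (ℕ.m≤m+n a b)) (ℕ.s≤s (ℕ.m≤n+m b a))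

-- Natural-number values for x ≥ 2

-- For x = 2 + X the solution with f 0 = a and f 1 = a + X stays in ℕ: writing gapℕ k for
-- f (k + 1) - f k, the recurrence reads gapℕ (k + 1) = X * f (k + 1) + gapℕ k.
mutual
  seqℕ : ℕ → ℕ → ℕ → ℕ
  seqℕ X a zero = a
  seqℕ X a (suc k) = seqℕ X a k ℕ.+ gapℕ X a k

  gapℕ : ℕ → ℕ → ℕ → ℕ
  gapℕ X a zero = X
  gapℕ X a (suc k) = X ℕ.* seqℕ X a (suc k) ℕ.+ gapℕ X a k

seqℕ-solves : ∀ X a → Solves (+ (2 ℕ.+ X)) (λ k → + seqℕ X a k)
seqℕ-solves X a = solves λ k → step (seqℕ X a k) (gapℕ X a k)
  where
  step : ∀ s d → + (s ℕ.+ d ℕ.+ (X ℕ.* (s ℕ.+ d) ℕ.+ d)) ≡ + (2 ℕ.+ X) * + (s ℕ.+ d) - + s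
  step s d = trans (cong (λ z → + s + + d + (z + + d)) (ℤ.pos-* X (s ℕ.+ d))) (lemma (+ s) (+ d) (+ X))
    where
    lemma : ∀ s d X → s + d + (X * (s + d) + d) ≡ (+ 2 + X) * (s + d) - s
    lemma = solve-∀

r≡seqℕ : ∀ X k → r k (+ (2 ℕ.+ X)) ≡ + seqℕ X 1 k
r≡seqℕ X = solves-unique (r-solves _) (seqℕ-solves X 1) refl refl

T≡seqℕ : ∀ X k → T k (+ (2 ℕ.+ X)) ≡ + seqℕ X 2 k
T≡seqℕ X = solves-unique (T-solves _) (seqℕ-solves X 2) refl refl

X≤gapℕ : ∀ X a k → X ℕ.≤ gapℕ X a k
X≤gapℕ X a zero = ℕ.≤-refl
X≤gapℕ X a (suc k) = ℕ.≤-trans (X≤gapℕ X a k) (ℕ.m≤n+m _ _)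

seqℕ-monoʳ-≤ : ∀ X a {k k′} → k ℕ.≤ k′ → seqℕ X a k ℕ.≤ seqℕ X a k′
seqℕ-monoʳ-≤ X a k≤k′ = go (ℕ.≤⇒≤′ k≤k′)
  where
  go : ∀ {k k′} → k ℕ.≤′ k′ → seqℕ X a k ℕ.≤ seqℕ X a k′
  go ℕ.≤′-refl = ℕ.≤-refl
  go (ℕ.≤′-step k≤′k′) = ℕ.≤-trans (go k≤′k′) (ℕ.m≤m+n _ _)

seqℕ-monoʳ-< : ∀ {X} a {k k′} → 1 ℕ.≤ X → k ℕ.< k′ → seqℕ X a k ℕ.< seqℕ X a k′
seqℕ-monoʳ-< {X} a {k} 1≤X k<k′ =
  ℕ.<-≤-trans (ℕ.m<m+n (seqℕ X a k) (ℕ.≤-trans 1≤X (X≤gapℕ X a k))) (seqℕ-monoʳ-≤ X a k<k′)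

seqℕ-monoˡ-≤ : ∀ {X Y} a → Y ℕ.≤ X → ∀ k → seqℕ Y a k ℕ.≤ seqℕ X a k × gapℕ Y a k ℕ.≤ gapℕ X a k
seqℕ-monoˡ-≤ a Y≤X zero = ℕ.≤-refl , Y≤X
seqℕ-monoˡ-≤ {X} {Y} a Y≤X (suc k) with seqℕ-monoˡ-≤ a Y≤X k
... | seq≤ , gap≤ = seq′≤ , ℕ.+-mono-≤ (ℕ.*-mono-≤ Y≤X seq′≤) gap≤
  where
  seq′≤ : seqℕ Y a (suc k) ℕ.≤ seqℕ X a (suc k)
  seq′≤ = ℕ.+-mono-≤ seq≤ gap≤

gapℕ-monoˡ-< : ∀ {X Y} a → Y ℕ.< X → ∀ k → gapℕ Y a k ℕ.< gapℕ X a k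
gapℕ-monoˡ-< a Y<X zero = Y<X
gapℕ-monoˡ-< a Y<X (suc k) =
  ℕ.+-mono-≤-< (ℕ.*-mono-≤ (ℕ.<⇒≤ Y<X) (proj₁ (seqℕ-monoˡ-≤ a (ℕ.<⇒≤ Y<X) (suc k)))) (gapℕ-monoˡ-< a Y<X k)

seqℕ-monoˡ-< : ∀ {X Y} a → Y ℕ.< X → ∀ k → seqℕ Y a (suc k) ℕ.< seqℕ X a (suc k)
seqℕ-monoˡ-< a Y<X k = ℕ.+-mono-≤-< (proj₁ (seqℕ-monoˡ-≤ a (ℕ.<⇒≤ Y<X) k)) (gapℕ-monoˡ-< a Y<X k)

1<seqℕ : ∀ {X} k → 1 ℕ.≤ X → 1 ℕ.≤ k → 1 ℕ.< seqℕ X 1 k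
1<seqℕ {X} k 1≤X 1≤k = ℕ.≤-trans (ℕ.s≤s 1≤X) (seqℕ-monoʳ-≤ X 1 1≤k)

T-grows : ∀ {X} p → 1 ℕ.≤ X → 2 ℕ.≤ p → ∃[ Y ] X ℕ.< Y × T p (+ (2 ℕ.+ X)) ≡ + (2 ℕ.+ Y)
T-grows {X} p 1≤X 2≤p with ℕ.m≤n⇒∃[o]m+o≡n (ℕ.<-≤-trans x<T₂ (seqℕ-monoʳ-≤ X 2 2≤p))
  where
  x<T₂ : 2 ℕ.+ X ℕ.< seqℕ X 2 2
  x<T₂ = ℕ.m<m+n (2 ℕ.+ X) (ℕ.≤-trans 1≤X (ℕ.m≤n+m X _))
... | o , eq = suc (X ℕ.+ o) , ℕ.s≤s (ℕ.m≤m+n X o) , trans (T≡seqℕ X p) (cong +_ (sym eq))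

seqℕ-∣ : ∀ X a b → odd a ∣ odd b → seqℕ X 1 a ∣ seqℕ X 1 b
seqℕ-∣ X a b a∣b = ℤᵈ.∣⇒∣ᵤ (subst₂ _∣ℤ_ (r≡seqℕ X a) (r≡seqℕ X b) (r-∣-r (+ (2 ℕ.+ X)) a b a∣b))

seqℕ-composition : ∀ {X Y} h → T (odd h) (+ (2 ℕ.+ X)) ≡ + (2 ℕ.+ Y) →
                   ∀ c → seqℕ Y 1 c ℕ.* seqℕ X 1 h ≡ seqℕ X 1 (c ℕ.* odd h ℕ.+ h)
seqℕ-composition {X} {Y} h T≡ c = ℤ.+-injective (begin
  + (seqℕ Y 1 c ℕ.* seqℕ X 1 h)                     ≡⟨ ℤ.pos-* (seqℕ Y 1 c) (seqℕ X 1 h) ⟩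
  + seqℕ Y 1 c * + seqℕ X 1 h                       ≡⟨ cong₂ _*_ (sym (r≡seqℕ Y c)) (sym (r≡seqℕ X h)) ⟩
  r c (+ (2 ℕ.+ Y)) * r h (+ (2 ℕ.+ X))             ≡⟨ cong (λ n → r c n * r h (+ (2 ℕ.+ X))) (sym T≡) ⟩
  r c (T (odd h) (+ (2 ℕ.+ X))) * r h (+ (2 ℕ.+ X)) ≡⟨ r-T-composition (+ (2 ℕ.+ X)) h c ⟩
  r (c ℕ.* odd h ℕ.+ h) (+ (2 ℕ.+ X))               ≡⟨ r≡seqℕ X (c ℕ.* odd h ℕ.+ h) ⟩
  + seqℕ X 1 (c ℕ.* odd h ℕ.+ h)                    ∎)
  where open ≡-Reasoning

seqℕ-coprime : ∀ X h k → Prime (odd h) → ¬ odd h ∣ odd k → Coprime (seqℕ X 1 k) (seqℕ X 1 h)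
seqℕ-coprime X h k pr p∤k {d} (d∣k , d∣h) with r-common-divisor (+ (2 ℕ.+ X)) k h (lift k d∣k) (lift h d∣h)
  where
  lift : ∀ a → d ∣ seqℕ X 1 a → + d ∣ℤ r a (+ (2 ℕ.+ X))
  lift a d∣a = subst (+ d ∣ℤ_) (sym (r≡seqℕ X a)) (ℤᵈ.∣ᵤ⇒∣ d∣a)
... | c , c∣k , c∣h , d∣rc with prime⇒irreducible pr c∣h
...   | inj₂ c≡h = ⊥-elim (p∤k (subst (_∣ odd k) c≡h c∣k))
...   | inj₁ c≡0 with odd-injective {c} {0} c≡0
...     | refl = ∣1⇒≡1 (ℤᵈ.∣⇒∣ᵤ d∣rc)

¬prime⇒¬IsPrimeℤ : ∀ {m} → ¬ Prime m → ¬ IsPrimeℤ (+ m)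
¬prime⇒¬IsPrimeℤ ¬pr (p , eq , pr) = ¬pr (subst Prime (sym (ℤ.+-injective eq)) pr)

isPrimeℤ? : ∀ z → Dec (IsPrimeℤ z)
isPrimeℤ? (+ m) with prime? m
... | yes pr = yes (m , refl , pr)
... | no ¬pr = no (¬prime⇒¬IsPrimeℤ ¬pr)
isPrimeℤ? -[1+ m ] = no λ { (_ , () , _) }

¬prime-by-divisor : ∀ {d n} → 1 ℕ.< d → d ℕ.< n → d ∣ n → ¬ Prime n
¬prime-by-divisor {d} 1<d d<n d∣n = composite⇒¬prime (composite d<n d∣n)
  where
  instance
    d-nonTrivial : NonTrivial d
    d-nonTrivial = ℕ.n>1⇒nonTrivial 1<d

m*p≡a*b∧p∣a⇒b≤m : ∀ {m p a b} .{{_ : NonZero p}} → m ℕ.* p ≡ a ℕ.* b → p ∣ a → 0 ℕ.< a → b ℕ.≤ m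
m*p≡a*b∧p∣a⇒b≤m {m} {p} {b = b} eq (divides (suc q) refl) 0<a =
  subst (b ℕ.≤_) (sym m≡) (ℕ.m≤m+n b (q ℕ.* b))
  where
  m≡ : m ≡ suc q ℕ.* b
  m≡ = ℕ.*-cancelʳ-≡ m (suc q ℕ.* b) p (trans eq (swap (suc q) p b))
    where
    swap : ∀ q p b → q ℕ.* p ℕ.* b ≡ q ℕ.* b ℕ.* p
    swap = ℕ-solve-∀

m*p≡a*b⇒a≤m⊎b≤m : ∀ {m p a b} → Prime p → m ℕ.* p ≡ a ℕ.* b → 0 ℕ.< a → 0 ℕ.< b → a ℕ.≤ m ⊎ b ℕ.≤ m
m*p≡a*b⇒a≤m⊎b≤m {m} {p} {a} {b} pr eq 0<a 0<b with euclidsLemma a b pr (divides m (sym eq))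
... | inj₁ p∣a = inj₂ (m*p≡a*b∧p∣a⇒b≤m {{prime⇒nonZero pr}} eq p∣a 0<a)
... | inj₂ p∣b = inj₁ (m*p≡a*b∧p∣a⇒b≤m {{prime⇒nonZero pr}} (trans eq (ℕ.*-comm a b)) p∣b 0<b)

difference-of-squares-¬prime : ∀ {L M P R} → suc M ≡ L ℕ.* L → L ℕ.< P →
                               suc (M ℕ.* R) ≡ (L ℕ.* P) ℕ.* (L ℕ.* P) → ¬ Prime R
difference-of-squares-¬prime {suc L} {M} {suc P} {R} M≡ L<P eq pr =
  [ ℕ.<⇒≱ M<A , ℕ.<⇒≱ M<2+A ]′
    (m*p≡a*b⇒a≤m⊎b≤m pr (ℕ.suc-injective (trans eq (square A))) (ℕ.≤-<-trans ℕ.z≤n M<A) ℕ.z<s)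
  where
  A : ℕ
  A = P ℕ.+ L ℕ.* suc P
  square : ∀ A → suc A ℕ.* suc A ≡ suc (A ℕ.* (2 ℕ.+ A))
  square = ℕ-solve-∀
  M<A : M ℕ.< A
  M<A = ℕ.≤-pred (subst (ℕ._< suc A) (sym M≡) (ℕ.*-monoʳ-< (suc L) L<P))
  M<2+A : M ℕ.< 2 ℕ.+ A
  M<2+A = ℕ.<-trans M<A (ℕ.m<n+m A {2} ℕ.z<s)

sole-candidate : ∀ {n h} → 1 ℕ.≤ h → (∀ k → ¬ k ≡ h → ¬ IsPrimeℤ (r k n)) →
  ((¬ IsPrimeℤ (r h n)) × ATilde n -[1+ 0 ])
  ⊎ (IsPrimeℤ (r h n) × (∀ k → IsPrimeℤ (r k n) → k ≡ h) × ATilde n (+ h))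
sole-candidate {n} {h} 1≤h others with isPrimeℤ? (r h n)
... | no ¬prime = inj₁ (¬prime , inj₁ (refl , none))
  where
  none : ∀ k → ¬ IsPrimeℤ (r k n)
  none k with k ℕ.≟ h
  ... | yes refl = ¬prime
  ... | no k≢h = others k k≢h
... | yes prime = inj₂ (prime , only , inj₂ (h , refl , 1≤h , prime , below))
  where
  only : ∀ k → IsPrimeℤ (r k n) → k ≡ h
  only k pk = decidable-stable (k ℕ.≟ h) (λ k≢h → others k k≢h pk)
  below : ∀ m → 1 ℕ.≤ m → m ℕ.< h → ¬ IsPrimeℤ (r m n)
  below m _ m<h = others m (ℕ.<⇒≢ m<h)

-- Chebyshev values of odd prime degree

seqℕ-¬prime-multiple : ∀ {Y} h k → 1 ℕ.≤ Y → 1 ℕ.≤ h → odd h ∣ odd k → ¬ k ≡ h → ¬ Prime (seqℕ Y 1 k)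
seqℕ-¬prime-multiple {Y} h k 1≤Y 1≤h h∣k k≢h with odd∣odd⇒≡*odd+ h k h∣k
... | zero , refl = ⊥-elim (k≢h refl)
... | suc c , refl = ¬prime-by-divisor (1<seqℕ h 1≤Y 1≤h) h<k (seqℕ-∣ Y h _ h∣k)
  where
  h<k : seqℕ Y 1 h ℕ.< seqℕ Y 1 (suc c ℕ.* odd h ℕ.+ h)
  h<k = seqℕ-monoʳ-< 1 {h} {suc c ℕ.* odd h ℕ.+ h} 1≤Y (ℕ.m<n+m h ℕ.z<s)

seqℕ-¬prime-coprime : ∀ {X Y} h k → 1 ℕ.≤ X → X ℕ.< Y → Prime (odd h) →
                      T (odd h) (+ (2 ℕ.+ X)) ≡ + (2 ℕ.+ Y) →
                      ¬ odd h ∣ odd (suc k) → ¬ Prime (seqℕ Y 1 (suc k))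
seqℕ-¬prime-coprime {X} {Y} h k 1≤X X<Y pr T≡ p∤k =
  ¬prime-by-divisor (1<seqℕ (suc k) 1≤X (ℕ.s≤s ℕ.z≤n)) (seqℕ-monoˡ-< 1 X<Y k)
    (coprime-divisor (seqℕ-coprime X h (suc k) pr p∤k) (subst (seqℕ X 1 (suc k) ∣_) progression≡product ∣progression))
  where
  ∣progression : seqℕ X 1 (suc k) ∣ seqℕ X 1 (suc k ℕ.* odd h ℕ.+ h)
  ∣progression = seqℕ-∣ X (suc k) _
    (divides (odd h) (trans (sym (odd-*-odd (suc k) h)) (ℕ.*-comm (odd (suc k)) (odd h))))
  progression≡product : seqℕ X 1 (suc k ℕ.* odd h ℕ.+ h) ≡ seqℕ X 1 h ℕ.* seqℕ Y 1 (suc k)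
  progression≡product = trans (sym (seqℕ-composition h T≡ (suc k))) (ℕ.*-comm (seqℕ Y 1 (suc k)) (seqℕ X 1 h))

r-T-odd-¬prime : ∀ {X h} → 1 ℕ.≤ X → 1 ℕ.≤ h → Prime (odd h) →
                 ∀ k → ¬ k ≡ h → ¬ IsPrimeℤ (r k (T (odd h) (+ (2 ℕ.+ X))))
r-T-odd-¬prime {X} {h} 1≤X 1≤h pr k k≢h with T-grows (odd h) 1≤X (ℕ.s≤s (ℕ.≤-trans 1≤h (ℕ.m≤m+n h h)))
... | Y , X<Y , T≡ rewrite T≡ | r≡seqℕ Y k = ¬prime⇒¬IsPrimeℤ (¬prime k k≢h)
  where
  ¬prime : ∀ k → ¬ k ≡ h → ¬ Prime (seqℕ Y 1 k)
  ¬prime zero _ = ¬prime[1]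
  ¬prime (suc k) k≢h with odd h ∣? odd (suc k)
  ... | yes h∣k = seqℕ-¬prime-multiple h (suc k) (ℕ.≤-trans 1≤X (ℕ.<⇒≤ X<Y)) 1≤h h∣k k≢h
  ... | no h∤k = seqℕ-¬prime-coprime h k 1≤X X<Y pr T≡ h∤k

-- Chebyshev values of degree 2

cassini : ∀ x k → r (suc k) x * r (suc k) x - x * r (suc k) x * r k x + r k x * r k x ≡ + 2 - x
cassini x zero = lemma x
  where
  lemma : ∀ x → (x - + 1) * (x - + 1) - x * (x - + 1) * + 1 + + 1 * + 1 ≡ + 2 - x
  lemma = solve-∀
cassini x (suc k) = trans (lemma x (r (suc k) x) (r k x)) (cassini x k)
  where
  lemma : ∀ x a b → (x * a - b) * (x * a - b) - x * (x * a - b) * a + a * a ≡ a * a - x * a * b + b * b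
  lemma = solve-∀

squares-solve : ∀ x → Solves (T 2 x) (λ k → (x + + 2) * (r k x * r k x) - + 2)
squares-solve x = solves λ k → step (r (suc k) x) (r k x) (cassini x k)
  where
  v : ℤ → ℤ
  v a = (x + + 2) * (a * a) - + 2
  -- The defect of the recurrence is 2(x + 2) times the defect of Cassini's identity.
  expand : ∀ x a b → (x + + 2) * ((x * a - b) * (x * a - b)) - + 2
                   ≡ ((x * x - + 2) * ((x + + 2) * (a * a) - + 2) - ((x + + 2) * (b * b) - + 2))
                     + + 2 * (x + + 2) * ((a * a - x * a * b + b * b) - (+ 2 - x))
  expand = solve-∀
  vanish : ∀ u v w → u + v * (w - w) ≡ u
  vanish = solve-∀
  step : ∀ a b → a * a - x * a * b + b * b ≡ + 2 - x → v (x * a - b) ≡ T 2 x * v a - v b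
  step a b cas = begin
    v (x * a - b)
      ≡⟨ expand x a b ⟩
    (T 2 x * v a - v b) + + 2 * (x + + 2) * ((a * a - x * a * b + b * b) - (+ 2 - x))
      ≡⟨ cong (λ q → (T 2 x * v a - v b) + + 2 * (x + + 2) * (q - (+ 2 - x))) cas ⟩
    (T 2 x * v a - v b) + + 2 * (x + + 2) * ((+ 2 - x) - (+ 2 - x))
      ≡⟨ vanish _ (+ 2 * (x + + 2)) (+ 2 - x) ⟩
    T 2 x * v a - v b ∎
    where open ≡-Reasoning

square-identity : ∀ x k → r k (T 2 x) * x ≡ (x + + 2) * (r k x * r k x) - + 2
square-identity x = solves-unique (solves-*ʳ x (r-solves (T 2 x))) (squares-solve x) (zeroth x) (first x)
  where
  zeroth : ∀ x → + 1 * x ≡ (x + + 2) * (+ 1 * + 1) - + 2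
  zeroth = solve-∀
  first : ∀ x → ((x * x - + 2) - + 1) * x ≡ (x + + 2) * ((x - + 1) * (x - + 1)) - + 2
  first = solve-∀

pos-square-identity : ∀ R J P → + R * + J ≡ (+ J + + 2) * (+ P * + P) - + 2 →
                      R ℕ.* J ℕ.+ 2 ≡ (J ℕ.+ 2) ℕ.* (P ℕ.* P)
pos-square-identity R J P eq = ℤ.+-injective (begin
  + (R ℕ.* J) + + 2                              ≡⟨ cong (_+ + 2) (ℤ.pos-* R J) ⟩
  + R * + J + + 2                                ≡⟨ cong (_+ + 2) eq ⟩
  ((+ J + + 2) * (+ P * + P) - + 2) + + 2        ≡⟨ cancel ((+ J + + 2) * (+ P * + P)) ⟩
  + (J ℕ.+ 2) * (+ P * + P)                      ≡⟨ cong (+ (J ℕ.+ 2) *_) (sym (ℤ.pos-* P P)) ⟩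
  + (J ℕ.+ 2) * + (P ℕ.* P)                      ≡⟨ sym (ℤ.pos-* (J ℕ.+ 2) (P ℕ.* P)) ⟩
  + ((J ℕ.+ 2) ℕ.* (P ℕ.* P))                    ∎)
  where
  open ≡-Reasoning
  cancel : ∀ a → (a - + 2) + + 2 ≡ a
  cancel = solve-∀

-- With ℓ = 2 + t we have ℓ² - 1 = 1 + W and 2(ℓ² - 1) = 2 + 2W.
module _ (t : ℕ) where
  private
    L W : ℕ
    L = 2 ℕ.+ t
    W = 2 ℕ.+ t ℕ.* (4 ℕ.+ t)

  T₂-argument : + 2 * (+ L * + L - + 1) ≡ + (2 ℕ.+ 2 ℕ.* W)
  T₂-argument = begin
    + 2 * (+ L * + L - + 1)               ≡⟨ expand (+ t) ⟩
    + 2 + + 2 * (+ 2 + + t * + (4 ℕ.+ t)) ≡⟨ cong (λ z → + 2 + + 2 * (+ 2 + z)) (sym (ℤ.pos-* t (4 ℕ.+ t))) ⟩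
    + 2 + + 2 * + W                       ≡⟨ cong (λ z → + 2 + z) (sym (ℤ.pos-* 2 W)) ⟩
    + (2 ℕ.+ 2 ℕ.* W)                     ∎
    where
    open ≡-Reasoning
    expand : ∀ τ → + 2 * ((+ 2 + τ) * (+ 2 + τ) - + 1) ≡ + 2 + + 2 * (+ 2 + τ * (+ 4 + τ))
    expand = solve-∀

  r-T₂-¬prime : ∀ k → ¬ IsPrimeℤ (r k (T 2 (+ 2 * (+ L * + L - + 1))))
  r-T₂-¬prime k = subst (λ J → ¬ IsPrimeℤ (r k (T 2 J))) (sym T₂-argument) (¬prime k)
    where
    J : ℤ
    J = + (2 ℕ.+ 2 ℕ.* W)
    ¬prime : ∀ k → ¬ IsPrimeℤ (r k (T 2 J))
    ¬prime zero = ¬prime⇒¬IsPrimeℤ ¬prime[1]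
    ¬prime (suc k) (R , eqR , prR) = difference-of-squares-¬prime (L² t) L<P identity prR
      where
      P : ℕ
      P = seqℕ (2 ℕ.* W) 1 (suc k)
      squares : + R * J ≡ (J + + 2) * (+ P * + P) - + 2
      squares = subst₂ (λ a b → a * J ≡ (J + + 2) * (b * b) - + 2) eqR (r≡seqℕ (2 ℕ.* W) (suc k))
                  (square-identity J (suc k))
      identity : suc (suc W ℕ.* R) ≡ (L ℕ.* P) ℕ.* (L ℕ.* P)
      identity = ℕ.*-cancelˡ-≡ _ _ 2 (begin
        2 ℕ.* suc (suc W ℕ.* R)               ≡⟨ halve W R ⟩
        R ℕ.* (2 ℕ.+ 2 ℕ.* W) ℕ.+ 2           ≡⟨ pos-square-identity R (2 ℕ.+ 2 ℕ.* W) P squares ⟩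
        (2 ℕ.+ 2 ℕ.* W ℕ.+ 2) ℕ.* (P ℕ.* P)   ≡⟨ double t P ⟩
        2 ℕ.* ((L ℕ.* P) ℕ.* (L ℕ.* P))       ∎)
        where
        open ≡-Reasoning
        halve : ∀ W R → 2 ℕ.* suc (suc W ℕ.* R) ≡ R ℕ.* (2 ℕ.+ 2 ℕ.* W) ℕ.+ 2
        halve = ℕ-solve-∀
        double : ∀ t P → (2 ℕ.+ 2 ℕ.* (2 ℕ.+ t ℕ.* (4 ℕ.+ t)) ℕ.+ 2) ℕ.* (P ℕ.* P)
                         ≡ 2 ℕ.* (((2 ℕ.+ t) ℕ.* P) ℕ.* ((2 ℕ.+ t) ℕ.* P))
        double = ℕ-solve-∀
      L² : ∀ t → suc (suc (2 ℕ.+ t ℕ.* (4 ℕ.+ t))) ≡ (2 ℕ.+ t) ℕ.* (2 ℕ.+ t)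
      L² = ℕ-solve-∀
      L<P : L ℕ.< P
      L<P = ℕ.≤-trans (ℕ.s≤s L≤2W) (seqℕ-monoʳ-≤ (2 ℕ.* W) 1 {1} {suc k} (ℕ.s≤s ℕ.z≤n))
        where
        L≤2W : L ℕ.≤ 2 ℕ.* W
        L≤2W = ℕ.≤-trans (ℕ.+-monoʳ-≤ 2 (ℕ.m≤m*n t (4 ℕ.+ t))) (ℕ.m≤m+n W (W ℕ.+ 0))

T₂-case : ∀ (ℓ n : ℤ) → + 2 ≤ ℓ → n ≡ T 2 (+ 2 * (ℓ * ℓ - + 1)) → ATilde n -[1+ 0 ]
T₂-case .(+ _) n (+≤+ 2≤L) refl with ℕ.m≤n⇒∃[o]m+o≡n 2≤L
... | t , refl = inj₁ (refl , r-T₂-¬prime t)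

Tₚ-case : ∀ (j n : ℤ) (p : ℕ) → + 3 ≤ j → Prime p → ¬ p ≡ 2 → n ≡ T p j →
  ((¬ IsPrimeℤ (r ⌊ p ∸ 1 /2⌋ n)) × ATilde n -[1+ 0 ])
  ⊎ (IsPrimeℤ (r ⌊ p ∸ 1 /2⌋ n)
     × (∀ (k : ℕ) → IsPrimeℤ (r k n) → k ≡ ⌊ p ∸ 1 /2⌋)
     × ATilde n (+ ⌊ p ∸ 1 /2⌋))
Tₚ-case .(+ _) n p (+≤+ 3≤J) pr p≢2 refl with ℕ.m≤n⇒∃[o]m+o≡n 3≤J | odd-prime pr p≢2
... | X , refl | h , 1≤h , refl rewrite sym (ℕ.n≡⌊n+n/2⌋ h) =
  sole-candidate 1≤h (r-T-odd-¬prime (ℕ.s≤s ℕ.z≤n) 1≤h pr)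

theorem46 : (∀ (ℓ n : ℤ) → + 2 ≤ ℓ → n ≡ T 2 (+ 2 * (ℓ * ℓ - + 1)) → ATilde n -[1+ 0 ])
    × (∀ (j n : ℤ) (p : ℕ) → + 3 ≤ j → Prime p → ¬ p ≡ 2 → n ≡ T p j →
        ((¬ IsPrimeℤ (r ⌊ p ∸ 1 /2⌋ n)) × ATilde n -[1+ 0 ])
        ⊎ (IsPrimeℤ (r ⌊ p ∸ 1 /2⌋ n)
           × (∀ (k : ℕ) → IsPrimeℤ (r k n) → k ≡ ⌊ p ∸ 1 /2⌋)
           × ATilde n (+ ⌊ p ∸ 1 /2⌋)))
theorem46 = T₂-case , Tₚ-case
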